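{- For every integer $v\geq 4$ there are two graphs $G$ and $G'$ on the same set of $v$ vertices which are $3$-hypomorphic up to complementation but not isomorphic up to complementation.
   Context: A graph is a pair $G=(V,E)$ with $E$ a set of 2-element subsets of $V$; $\overline G$ is its complement and $G_{\restriction K}$ the induced subgraph on $K$. Two graphs are isomorphic up to complementation if one is isomorphic to the other or to its complement; $G,G'$ on $V$ are $k$-hypomorphic up to complementation if $G_{\restriction K}$ and $G'_{\restriction K}$ are isomorphic up to complementation for every $k$-element $K\subseteq V$. -}

module Defs where

open import Data.Nat using (ℕ)
open import Data.Bool using (Bool; true; false; not; if_then_else_)
open import Data.Empty using (⊥-elim)
open import Data.Fin using (Fin)
open import Data.Fin.Properties using (_≟_)
open import Data.Fin.Subset using (Subset; _∈_; ∣_∣)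
open import Data.Product using (Σ; Σ-syntax; _×_; proj₁)
open import Data.Sum using (_⊎_)
open import Relation.Binary.PropositionalEquality using (_≡_; refl; sym; cong)
open import Relation.Nullary using (¬_; yes; no; does)
open import Relation.Nullary.Decidable using (dec-true)
open import Function.Bundles using (_⤖_; Bijection)

record Graph (V : Set) : Set where
  field
    adj    : V → V → Bool
    symm   : ∀ x y → adj x y ≡ adj y x
    irrefl : ∀ x → adj x x ≡ false
open Graph public

complAdj : ∀ {v} → Graph (Fin v) → Fin v → Fin v → Bool
complAdj G x y = if does (x ≟ y) then false else not (adj G x y)

complement : ∀ {v} → Graph (Fin v) → Graph (Fin v)
complement {v} G = record { adj = complAdj G ; symm = s ; irrefl = i }
  where
    s : ∀ x y → complAdj G x y ≡ complAdj G y x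
    s x y with x ≟ y | y ≟ x
    ... | yes _ | yes _ = refl
    ... | yes p | no q = ⊥-elim (q (sym p))
    ... | no q | yes p = ⊥-elim (q (sym p))
    ... | no _ | no _ = cong not (symm G x y)
    i : ∀ x → complAdj G x x ≡ false
    i x rewrite dec-true (x ≟ x) refl = refl

_≅_ : {V W : Set} → Graph V → Graph W → Set
_≅_ {V} {W} G H =
  Σ[ f ∈ V ⤖ W ] (∀ x y → adj G x y ≡ adj H (Bijection.to f x) (Bijection.to f y))

Elems : ∀ {v} → Subset v → Set
Elems {v} K = Σ[ x ∈ Fin v ] (x ∈ K)

induced : ∀ {v} → Graph (Fin v) → (K : Subset v) → Graph (Elems K)
induced G K = record
  { adj = λ x y → adj G (proj₁ x) (proj₁ y)
  ; symm = λ x y → symm G (proj₁ x) (proj₁ y)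
  ; irrefl = λ x → irrefl G (proj₁ x) }

IsoUpToCompl : ∀ {v} → Graph (Fin v) → Graph (Fin v) → Set
IsoUpToCompl G H = (G ≅ H) ⊎ (G ≅ complement H)

-- Note: the complement of G'↾K is literally (complement G')↾K (same vertex
-- set Elems K, same adjacency on distinct vertices), so we use the latter.
HypoUpToCompl : ∀ {v} → ℕ → Graph (Fin v) → Graph (Fin v) → Set
HypoUpToCompl {v} k G G' =
  (K : Subset v) → ∣ K ∣ ≡ k →
  (induced G K ≅ induced G' K) ⊎ (induced G K ≅ induced (complement G') K)

module Submission where

-- G is a star centred at 0 with leaves 2, …, v−1 and an isolated vertex 1; G' is the full
-- star centred at 0. On a 3-set avoiding 0 or 1 the two graphs coincide, and on {0, 1, a}
-- swapping 0 and 1 maps G↾K = {0a} onto the complement {1a} of the path 1–0–a. Yet G has an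
-- isolated vertex and G' has none, while the complement of G' contains the triangle {1, 2, 3}
-- (here v ≥ 4 is used) and the star G is triangle-free.

open import Defs
open import Data.Nat using (ℕ; _≥_; suc; s≤s; z≤n)
open import Data.Nat.Properties using (suc-injective)
open import Data.Fin using (Fin) renaming (zero to fz; suc to fs)
open import Data.Fin.Subset using (Subset; _∈_; _∉_; ∣_∣; inside; outside)
open import Data.Fin.Subset.Properties using (drop-there)
open import Data.Vec using (_∷_; here; there)
open import Data.Bool using (Bool; true; false)
open import Data.Empty using (⊥; ⊥-elim)
open import Data.Product using (Σ-syntax; _×_; _,_; proj₁; proj₂)
open import Data.Sum using (inj₁; inj₂)
open import Relation.Nullary using (¬_)
open import Relation.Binary.PropositionalEquality using (_≡_; _≢_; refl; sym; trans; cong)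
open import Function.Bundles using (_⤖_; Bijection; mk↔ₛ′)
open import Function.Construct.Identity using (⤖-id)
open import Function.Properties.Inverse using (↔⇒⤖)

module _ {V : Set} (G : Graph V) where

  NoIsolatedVertex : Set
  NoIsolatedVertex = ∀ x → Σ[ y ∈ V ] adj G x y ≡ true

  Triangle : Set
  Triangle = Σ[ a ∈ V ] Σ[ b ∈ V ] Σ[ c ∈ V ]
    (adj G a b ≡ true × adj G b c ≡ true × adj G a c ≡ true)

module _ {V W : Set} {G : Graph V} {H : Graph W} (G≅H : G ≅ H) where

  open Bijection (proj₁ G≅H) using (to; strictlySurjective)

  private
    to-adj : ∀ x y → adj G x y ≡ adj H (to x) (to y)
    to-adj = proj₂ G≅H

  NoIsolatedVertex-pullback : NoIsolatedVertex H → NoIsolatedVertex G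
  NoIsolatedVertex-pullback noIso x with noIso (to x)
  ... | y′ , e with strictlySurjective y′
  ... | y , refl = y , trans (to-adj x y) e

  Triangle-pullback : Triangle H → Triangle G
  Triangle-pullback (a′ , b′ , c′ , ab , bc , ac)
    with strictlySurjective a′ | strictlySurjective b′ | strictlySurjective c′
  ... | a , refl | b , refl | c , refl =
    a , b , c , trans (to-adj a b) ab , trans (to-adj b c) bc , trans (to-adj a c) ac

induced-≅ : ∀ {v} {G G′ : Graph (Fin v)} (K : Subset v) →
  (∀ {x y} → x ∈ K → y ∈ K → adj G x y ≡ adj G′ x y) → induced G K ≅ induced G′ K
induced-≅ K agree = ⤖-id _ , λ (_ , x∈K) (_ , y∈K) → agree x∈K y∈K

∣p∣≡0⇒∉ : ∀ {n} (p : Subset n) → ∣ p ∣ ≡ 0 → ∀ {x} → x ∉ p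
∣p∣≡0⇒∉ (outside ∷ p) e {fs x} x∈p = ∣p∣≡0⇒∉ p e (drop-there x∈p)
∣p∣≡0⇒∉ (inside ∷ p) ()

∣p∣≡1⇒∈-unique : ∀ {n} (p : Subset n) → ∣ p ∣ ≡ 1 → ∀ {x y} → x ∈ p → y ∈ p → x ≡ y
∣p∣≡1⇒∈-unique (outside ∷ p) e {fs x} {fs y} x∈p y∈p =
  cong fs (∣p∣≡1⇒∈-unique p e (drop-there x∈p) (drop-there y∈p))
∣p∣≡1⇒∈-unique (inside ∷ p) e {fz} {fz} _ _ = refl
∣p∣≡1⇒∈-unique (inside ∷ p) e {fz} {fs y} _ y∈p =
  ⊥-elim (∣p∣≡0⇒∉ p (suc-injective e) (drop-there y∈p))
∣p∣≡1⇒∈-unique (inside ∷ p) e {fs x} x∈p _ =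
  ⊥-elim (∣p∣≡0⇒∉ p (suc-injective e) (drop-there x∈p))

module _ {m : ℕ} where

  starAdj : Bool → Fin (suc (suc m)) → Fin (suc (suc m)) → Bool
  starAdj b fz          fz          = false
  starAdj b fz          (fs fz)     = b
  starAdj b fz          (fs (fs _)) = true
  starAdj b (fs fz)     fz          = b
  starAdj b (fs fz)     (fs _)      = false
  starAdj b (fs (fs _)) fz          = true
  starAdj b (fs (fs _)) (fs _)      = false

  starAdj-symm : ∀ b x y → starAdj b x y ≡ starAdj b y x
  starAdj-symm b fz          fz          = refl
  starAdj-symm b fz          (fs fz)     = refl
  starAdj-symm b fz          (fs (fs _)) = refl
  starAdj-symm b (fs fz)     fz          = refl
  starAdj-symm b (fs fz)     (fs fz)     = refl
  starAdj-symm b (fs fz)     (fs (fs _)) = refl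
  starAdj-symm b (fs (fs _)) fz          = refl
  starAdj-symm b (fs (fs _)) (fs fz)     = refl
  starAdj-symm b (fs (fs _)) (fs (fs _)) = refl

  starAdj-irrefl : ∀ b x → starAdj b x x ≡ false
  starAdj-irrefl b fz          = refl
  starAdj-irrefl b (fs fz)     = refl
  starAdj-irrefl b (fs (fs _)) = refl

  star : Bool → Graph (Fin (suc (suc m)))
  star b = record { adj = starAdj b ; symm = starAdj-symm b ; irrefl = starAdj-irrefl b }

  star-agree : (K : Subset (suc (suc m))) → (fz ∈ K → fs fz ∈ K → ⊥) →
    ∀ {x y} → x ∈ K → y ∈ K → starAdj false x y ≡ starAdj true x y
  star-agree K ¬01 {fz}          {fs fz}     0∈K 1∈K = ⊥-elim (¬01 0∈K 1∈K)
  star-agree K ¬01 {fs fz}       {fz}        1∈K 0∈K = ⊥-elim (¬01 0∈K 1∈K)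
  star-agree K ¬01 {fz}          {fz}        _ _ = refl
  star-agree K ¬01 {fz}          {fs (fs _)} _ _ = refl
  star-agree K ¬01 {fs fz}       {fs _}      _ _ = refl
  star-agree K ¬01 {fs (fs _)}   {fz}        _ _ = refl
  star-agree K ¬01 {fs (fs _)}   {fs _}      _ _ = refl

  star-false-isolated : ∀ u → starAdj false (fs fz) u ≢ true
  star-false-isolated fz     ()
  star-false-isolated (fs _) ()

  star-true-noIsolatedVertex : NoIsolatedVertex (star true)
  star-true-noIsolatedVertex fz          = fs fz , refl
  star-true-noIsolatedVertex (fs fz)     = fz , refl
  star-true-noIsolatedVertex (fs (fs _)) = fz , refl

  star-leaves-nonadjacent : ∀ b i j → starAdj b (fs i) (fs j) ≢ true
  star-leaves-nonadjacent b fz     _ ()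
  star-leaves-nonadjacent b (fs _) _ ()

  star-triangle-free : ∀ b → ¬ Triangle (star b)
  star-triangle-free b (fz   , fz   , _    , ()  , _   , _)
  star-triangle-free b (fz   , fs _ , fz   , _   , _   , ())
  star-triangle-free b (fz   , fs i , fs j , _   , i~j , _)   = star-leaves-nonadjacent b i j i~j
  star-triangle-free b (fs i , fs j , _    , i~j , _   , _)   = star-leaves-nonadjacent b i j i~j
  star-triangle-free b (fs _ , fz   , fz   , _   , ()  , _)
  star-triangle-free b (fs i , fz   , fs j , _   , _   , i~j) = star-leaves-nonadjacent b i j i~j

  module Swap01 (K′ : Subset m) where

    K : Subset (suc (suc m))
    K = inside ∷ inside ∷ K′

    swap : Elems K → Elems K
    swap (fz          , here)       = fs fz , there here
    swap (fs fz       , there here) = fz , here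
    swap (fs (fs a)   , a∈K)        = fs (fs a) , a∈K

    swap-involutive : ∀ x → swap (swap x) ≡ x
    swap-involutive (fz        , here)       = refl
    swap-involutive (fs fz     , there here) = refl
    swap-involutive (fs (fs a) , _)          = refl

    swap-⤖ : Elems K ⤖ Elems K
    swap-⤖ = ↔⇒⤖ (mk↔ₛ′ swap swap swap-involutive swap-involutive)

    swap-star-complement : ∣ K′ ∣ ≡ 1 → ∀ x y →
      starAdj false (proj₁ x) (proj₁ y) ≡ complAdj (star true) (proj₁ (swap x)) (proj₁ (swap y))
    swap-star-complement _ (fz        , here)       (fz        , here)       = refl
    swap-star-complement _ (fz        , here)       (fs fz     , there here) = refl
    swap-star-complement _ (fz        , here)       (fs (fs _) , _)          = refl
    swap-star-complement _ (fs fz     , there here) (fz        , here)       = refl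
    swap-star-complement _ (fs fz     , there here) (fs fz     , there here) = refl
    swap-star-complement _ (fs fz     , there here) (fs (fs _) , _)          = refl
    swap-star-complement _ (fs (fs _) , _)          (fz        , here)       = refl
    swap-star-complement _ (fs (fs _) , _)          (fs fz     , there here) = refl
    swap-star-complement e (fs (fs a) , a∈K)        (fs (fs b) , b∈K)
      with ∣p∣≡1⇒∈-unique K′ e (drop-there (drop-there a∈K)) (drop-there (drop-there b∈K))
    ... | refl = sym (irrefl (complement (star true)) (fs (fs a)))

  star-3-hypomorphic : HypoUpToCompl 3 (star false) (star true)
  star-3-hypomorphic K@(outside ∷ _) _ =
    inj₁ (induced-≅ {G = star false} {star true} K (star-agree K λ ()))
  star-3-hypomorphic K@(inside ∷ outside ∷ _) _ =
    inj₁ (induced-≅ {G = star false} {star true} K (star-agree K λ { _ (there ()) }))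
  star-3-hypomorphic (inside ∷ inside ∷ K′) ∣K∣≡3 =
    inj₂ (swap-⤖ , swap-star-complement (suc-injective (suc-injective ∣K∣≡3)))
    where open Swap01 K′

complement-star-triangle : ∀ {n} → Triangle (complement (star {suc (suc n)} true))
complement-star-triangle = fs fz , fs (fs fz) , fs (fs (fs fz)) , refl , refl , refl

star-not-isoUpToCompl : ∀ {n} → ¬ IsoUpToCompl (star {suc (suc n)} false) (star true)
star-not-isoUpToCompl (inj₁ G≅G′)
  with NoIsolatedVertex-pullback {G = star false} {star true} G≅G′ star-true-noIsolatedVertex (fs fz)
... | u , 1~u = star-false-isolated u 1~u
star-not-isoUpToCompl (inj₂ G≅G′ᶜ) =
  star-triangle-free false
    (Triangle-pullback {G = star false} {complement (star true)} G≅G′ᶜ complement-star-triangle)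

proposition4p1 : (v : ℕ) → v ≥ 4 →
    Σ[ G ∈ Graph (Fin v) ] Σ[ G' ∈ Graph (Fin v) ]
      (HypoUpToCompl 3 G G' × ¬ IsoUpToCompl G G')
proposition4p1 (suc (suc (suc (suc n)))) (s≤s (s≤s (s≤s (s≤s z≤n)))) =
  star false , star true , star-3-hypomorphic , star-not-isoUpToCompl
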